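{- Let $r,s$ be integers with $3\le r\le s$ and $\frac{3r}{2}\le s<\frac{3r}{2}+1$. Then there is no connected bipartite graph $G$ with stable sets $U,W$, $V(G)=U\cup W$, $|U|=r$, $|W|=s$, such that $\lambda(\overline{G})=\lambda(G)+1$.
   Context: $\overline{G}$ denotes the complement of $G$. A set $S\subseteq V$ is a locating-dominating set (LD-set) of $G$ if every vertex of $V\setminus S$ has a neighbor in $S$ and for any two distinct $u,v\in V\setminus S$, $N_G(u)\cap S\neq N_G(v)\cap S$. $\lambda(G)$ is the minimum cardinality of an LD-set of $G$. -}

module Defs where

open import Data.Nat using (ℕ; zero; suc; _+_; _*_; _≤_; _<_)
open import Data.Fin using (Fin; toℕ)
open import Data.Fin.Subset using (Subset; _∈_; _∉_; ∣_∣)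
open import Data.Bool using (Bool; true; false; not; _∧_)
open import Data.Product using (Σ; _×_; ∃; _,_)
open import Relation.Binary.PropositionalEquality using (_≡_; _≢_)
open import Relation.Binary.Construct.Closure.ReflexiveTransitive using (Star)
open import Relation.Nullary using (¬_)

record Graph (n : ℕ) : Set where
  field
    adj   : Fin n → Fin n → Bool
    sym   : ∀ u v → adj u v ≡ adj v u
    irrefl : ∀ v → adj v v ≡ false
open Graph public

Adj : ∀ {n} → Graph n → Fin n → Fin n → Set
Adj G u v = adj G u v ≡ true

-- Complement graph: u ~ v in Ḡ iff u ≠ v and u ≁ v in G.
-- (Since adj is irreflexive, "not (adj u v)" would make loops; we
--  remove them by requiring u ≠ v via a decidable equality test.)
open import Data.Fin using (_≟_)
open import Relation.Nullary.Decidable using (⌊_⌋)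
open import Relation.Binary.PropositionalEquality using (refl; cong)
open import Data.Bool.Properties using (∧-comm)

private
  neq : ∀ {n} → Fin n → Fin n → Bool
  neq u v = not ⌊ u ≟ v ⌋

  neq-sym : ∀ {n} (u v : Fin n) → neq u v ≡ neq v u
  neq-sym u v with u ≟ v | v ≟ u
  ... | Relation.Nullary.yes _ | Relation.Nullary.yes _ = refl
  ... | Relation.Nullary.no _  | Relation.Nullary.no _  = refl
  ... | Relation.Nullary.yes refl | Relation.Nullary.no q = Data.Empty.⊥-elim (q refl)
    where import Data.Empty
  ... | Relation.Nullary.no p  | Relation.Nullary.yes refl = Data.Empty.⊥-elim (p refl)
    where import Data.Empty

  neq-irr : ∀ {n} (v : Fin n) → neq v v ≡ false
  neq-irr v with v ≟ v
  ... | Relation.Nullary.yes _ = refl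
  ... | Relation.Nullary.no p  = Data.Empty.⊥-elim (p refl)
    where import Data.Empty

complement : ∀ {n} → Graph n → Graph n
complement G = record
  { adj    = λ u v → not (adj G u v) ∧ neq u v
  ; sym    = λ u v → Relation.Binary.PropositionalEquality.cong₂ (λ a b → not a ∧ b) (sym G u v) (neq-sym u v)
  ; irrefl = λ v → Relation.Binary.PropositionalEquality.trans
               (cong (not (adj G v v) ∧_) (neq-irr v)) (∧-comm (not (adj G v v)) false)
  }

Connected : ∀ {n} → Graph n → Set
Connected G = ∀ u v → Star (Adj G) u v

IsLD : ∀ {n} → Graph n → Subset n → Set
IsLD G S =
  (∀ v → v ∉ S → ∃ λ w → w ∈ S × Adj G v w) ×
  (∀ u v → u ∉ S → v ∉ S → u ≢ v →
     ¬ (∀ w → w ∈ S → (Adj G u w → Adj G v w) × (Adj G v w → Adj G u w)))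

IsLDNumber : ∀ {n} → Graph n → ℕ → Set
IsLDNumber G k = (∃ λ S → IsLD G S × ∣ S ∣ ≡ k) × (∀ S → IsLD G S → k ≤ ∣ S ∣)

InU : ∀ {r s} → Fin (r + s) → Set
InU {r} v = toℕ v < r

BipartiteUW : ∀ r s → Graph (r + s) → Set
BipartiteUW r s G =
  (∀ u v → InU {r} {s} u → InU {r} {s} v → ¬ Adj G u v) ×
  (∀ u v → ¬ InU {r} {s} u → ¬ InU {r} {s} v → ¬ Adj G u v)

module Submission where

-- Proposition 4.9. Let G be a bipartite graph with sides U, W of sizes
-- r ≤ s, and let D be a minimum LD-set of G with λ(Ḡ) = ∣D∣ + 1.
--
-- 1. If no vertex outside D were adjacent to all of D, D would itself be
--    an LD-set of Ḡ. So some v₀ ∉ D dominates D; by bipartiteness D is then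
--    exactly the side not containing v₀, and D and ∁D are both stable.
-- 2. Exchange argument: view the neighbourhoods of the vertices outside D
--    as a family F of ∣∁D∣ points of the cube {0,1}ⁿ. If some direction
--    x ∈ D carried at most one edge of F, exchanging x for a suitable
--    vertex y ∉ D would give an LD-set of Ḡ of size ∣D∣.
-- 3. The hypercube inequality Σ_x weight(edges F x) ≤ 2(∣F∣ - 1), with
--    weight 3 for directions carrying two edges, then gives
--    3∣D∣ + 2 ≤ 2∣∁D∣, which contradicts {∣D∣, ∣∁D∣} = {r, s} and
--    2s < 3r + 2.

open import Defs hiding (sym)
open import Data.Nat using (ℕ; zero; suc; _+_; _*_; _∸_; _≤_; _<_; z≤n; s≤s; s≤s⁻¹; _≤?_; _<?_)
open import Data.Nat.Properties hiding (_≟_)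
open import Data.Nat.Tactic.RingSolver using (solve-∀)
open import Data.Bool using (Bool; true; false; not; _∧_; _∨_)
import Data.Bool.Properties as Bool
open import Data.Fin using (Fin; zero; suc; toℕ; _≟_)
import Data.Fin.Properties as Fin
open import Data.Fin.Subset using (Subset; _∈_; _∉_; ∣_∣; ∁; ⁅_⁆; _∪_; _-_; outside; inside)
open import Data.Fin.Subset.Properties
  using ( _∈?_; x∈p∪q⁺; x∈⁅x⁆; x∈p∧x≢y⇒x∈p-y; x∈p⇒∣p-x∣<∣p∣; ∣⁅x⁆∣≡1; p⊆q⇒∣p∣≤∣q∣
        ; ∣∁p∣≡n∸∣p∣; ∣p∣≤n; x∈∁p⇒x∉p; x∉p⇒x∈∁p; drop-there)
open import Data.Vec using (Vec; []; _∷_; here; there; lookup; tabulate; _[_]≔_)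
open import Data.Vec.Properties
  using (≡-dec; lookup∘tabulate; tabulate∘lookup; tabulate-cong; lookup∘update; lookup∘update′)
open import Data.List using (List; []; _∷_; length; map)
open import Data.List.Properties using (length-map)
open import Data.List.Membership.Propositional using () renaming (_∈_ to _∈ˡ_)
open import Data.List.Membership.Propositional.Properties using (∈-map⁺; ∈-map⁻)
open import Data.List.Relation.Unary.Any using (here; there; any?)
open import Data.Product using (∃; _×_; _,_; proj₁; proj₂)
open import Data.Sum using (_⊎_; inj₁; inj₂)
import Data.Sum
open import Data.Empty using (⊥; ⊥-elim)
open import Function using (_∘_)
open import Function.Bundles using (_⇔_; mk⇔)
open import Relation.Nullary using (¬_; ¬?; does; yes; no; _×-dec_; _→-dec_)
open import Relation.Nullary.Decidable using (⌊_⌋; dec-true)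
open import Relation.Binary.Definitions using (DecidableEquality)
open import Relation.Binary.PropositionalEquality
open import Algebra.Properties.CommutativeMonoid.Sum +-0-commutativeMonoid using (sum; ∑-distrib-+)
open import Algebra.Properties.CommutativeSemigroup +-commutativeSemigroup using (interchange)

bit : Bool → ℕ
bit true  = 1
bit false = 0

-- A family of points of the Boolean cube {0,1}ᵃ, given by its
-- characteristic function; lower F and upper F are its traces on the two
-- faces of the first coordinate.
Family : ℕ → Set
Family a = Vec Bool a → Bool

lower upper : ∀ {a} → Family (suc a) → Family a
lower F v = F (false ∷ v)
upper F v = F (true ∷ v)

∑cube : ∀ {a} → (Vec Bool a → ℕ) → ℕ
∑cube {zero}  f = f []
∑cube {suc a} f = ∑cube (λ v → f (false ∷ v)) + ∑cube (λ v → f (true ∷ v))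

∑cube-mono : ∀ {a} {f g : Vec Bool a → ℕ} → (∀ v → f v ≤ g v) → ∑cube f ≤ ∑cube g
∑cube-mono {zero}  f≤g = f≤g []
∑cube-mono {suc a} f≤g =
  +-mono-≤ (∑cube-mono (λ v → f≤g (false ∷ v))) (∑cube-mono (λ v → f≤g (true ∷ v)))

∑cube-+ : ∀ {a} (f g : Vec Bool a → ℕ) → ∑cube (λ v → f v + g v) ≡ ∑cube f + ∑cube g
∑cube-+ {zero}  f g = refl
∑cube-+ {suc a} f g =
  trans (cong₂ _+_ (∑cube-+ (λ v → f (false ∷ v)) (λ v → g (false ∷ v)))
                   (∑cube-+ (λ v → f (true ∷ v)) (λ v → g (true ∷ v))))
        (interchange (∑cube (λ v → f (false ∷ v))) (∑cube (λ v → g (false ∷ v)))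
                     (∑cube (λ v → f (true ∷ v))) (∑cube (λ v → g (true ∷ v))))

∑cube-0 : ∀ {a} → ∑cube {a} (λ _ → 0) ≡ 0
∑cube-0 {zero}  = refl
∑cube-0 {suc a} = cong₂ _+_ (∑cube-0 {a}) (∑cube-0 {a})

∣_∣ᶠ : ∀ {a} → Family a → ℕ
∣ F ∣ᶠ = ∑cube (λ v → bit (F v))

count-pointwise : ∀ {a} (F G H K : Family a) →
  (∀ v → bit (F v) + bit (G v) ≤ bit (H v) + bit (K v)) →
  ∣ F ∣ᶠ + ∣ G ∣ᶠ ≤ ∣ H ∣ᶠ + ∣ K ∣ᶠ
count-pointwise F G H K le = begin
  ∣ F ∣ᶠ + ∣ G ∣ᶠ                               ≡⟨ ∑cube-+ (λ v → bit (F v)) (λ v → bit (G v)) ⟨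
  ∑cube (λ v → bit (F v) + bit (G v))           ≤⟨ ∑cube-mono le ⟩
  ∑cube (λ v → bit (H v) + bit (K v))           ≡⟨ ∑cube-+ (λ v → bit (H v)) (λ v → bit (K v)) ⟩
  ∣ H ∣ᶠ + ∣ K ∣ᶠ                               ∎
  where open ≤-Reasoning

count-mono : ∀ {a} {F G : Family a} → (∀ v → F v ≡ true → G v ≡ true) → ∣ F ∣ᶠ ≤ ∣ G ∣ᶠ
count-mono {F = F} {G} F⊆G =
  ∑cube-mono λ v → bit-mono (F v) (G v) (F⊆G v)
  where
  bit-mono : ∀ x y → (x ≡ true → y ≡ true) → bit x ≤ bit y
  bit-mono false y    _   = z≤n
  bit-mono true  true _   = ≤-refl
  bit-mono true  false imp with () ← imp refl

count-∨∧ : ∀ {a} (F G : Family a) →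
  ∣ (λ v → F v ∨ G v) ∣ᶠ + ∣ (λ v → F v ∧ G v) ∣ᶠ ≡ ∣ F ∣ᶠ + ∣ G ∣ᶠ
count-∨∧ F G = ≤-antisym (count-pointwise _ _ _ _ λ v → ≤-reflexive (bits (F v) (G v)))
                         (count-pointwise _ _ _ _ λ v → ≤-reflexive (sym (bits (F v) (G v))))
  where
  bits : ∀ x y → bit (x ∨ y) + bit (x ∧ y) ≡ bit x + bit y
  bits true  true  = refl
  bits true  false = refl
  bits false true  = refl
  bits false false = refl

count-∨ : ∀ {a} (F G : Family a) → ∣ (λ v → F v ∨ G v) ∣ᶠ ≤ ∣ F ∣ᶠ + ∣ G ∣ᶠ
count-∨ F G = ≤-trans (m≤m+n _ _) (≤-reflexive (count-∨∧ F G))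

count-pos : ∀ {a} (F : Family a) (v : Vec Bool a) → F v ≡ true → 1 ≤ ∣ F ∣ᶠ
count-pos F []          Fv = ≤-reflexive (cong bit (sym Fv))
count-pos F (false ∷ v) Fv = ≤-trans (count-pos (lower F) v Fv) (m≤m+n _ _)
count-pos F (true ∷ v)  Fv = ≤-trans (count-pos (upper F) v Fv) (m≤n+m _ _)

count-two : ∀ {a} (F : Family a) (u v : Vec Bool a) →
  F u ≡ true → F v ≡ true → u ≢ v → 2 ≤ ∣ F ∣ᶠ
count-two F []          []          _  _  u≢v = ⊥-elim (u≢v refl)
count-two F (false ∷ u) (false ∷ v) Fu Fv u≢v =
  ≤-trans (count-two (lower F) u v Fu Fv (u≢v ∘ cong (false ∷_))) (m≤m+n _ _)
count-two F (true ∷ u)  (true ∷ v)  Fu Fv u≢v =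
  ≤-trans (count-two (upper F) u v Fu Fv (u≢v ∘ cong (true ∷_))) (m≤n+m _ _)
count-two F (false ∷ u) (true ∷ v)  Fu Fv _ = +-mono-≤ (count-pos (lower F) u Fu) (count-pos (upper F) v Fv)
count-two F (true ∷ u)  (false ∷ v) Fu Fv _ = +-mono-≤ (count-pos (lower F) v Fv) (count-pos (upper F) u Fu)

-- edges F x counts the edges of the cube in direction x with both ends in
-- F, i.e. the pairs {v , v[x]≔true} ⊆ F with v[x] = false.
edges : ∀ {a} → Family a → Fin a → ℕ
edges F zero    = ∣ (λ v → lower F v ∧ upper F v) ∣ᶠ
edges F (suc y) = edges (lower F) y + edges (upper F) y

edges-mono : ∀ {a} {F G : Family a} → (∀ v → F v ≡ true → G v ≡ true) →
  ∀ y → edges F y ≤ edges G y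
edges-mono F⊆G zero    = count-mono λ v → ∧-mono (F⊆G (false ∷ v)) (F⊆G (true ∷ v))
  where
  ∧-mono : ∀ {x y x′ y′} → (x ≡ true → x′ ≡ true) → (y ≡ true → y′ ≡ true) →
    x ∧ y ≡ true → x′ ∧ y′ ≡ true
  ∧-mono {true} {true} p q _ rewrite p refl | q refl = refl
edges-mono F⊆G (suc y) =
  +-mono-≤ (edges-mono (F⊆G ∘ (false ∷_)) y) (edges-mono (F⊆G ∘ (true ∷_)) y)

-- Edge counts are supermodular: every edge of F or of G is an edge of
-- F ∪ G, and an edge of both is also an edge of F ∩ G.
edges-supermodular : ∀ {a} (F G : Family a) (y : Fin a) →
  edges F y + edges G y ≤ edges (λ v → F v ∨ G v) y + edges (λ v → F v ∧ G v) y
edges-supermodular F G zero =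
  count-pointwise _ _ _ _ λ v → bits (F (false ∷ v)) (F (true ∷ v)) (G (false ∷ v)) (G (true ∷ v))
  where
  bits : ∀ a c b d → bit (a ∧ c) + bit (b ∧ d) ≤ bit ((a ∨ b) ∧ (c ∨ d)) + bit ((a ∧ b) ∧ (c ∧ d))
  bits true  true  _     _     = ≤-refl
  bits false false _     _     = ≤-reflexive (sym (+-identityʳ _))
  bits true  false false _     = z≤n
  bits true  false true  d     = m≤m+n (bit d) 0
  bits false true  false _     = z≤n
  bits false true  true  false = z≤n
  bits false true  true  true  = ≤-refl
edges-supermodular F G (suc y) = begin
  (eF₀ + eF₁) + (eG₀ + eG₁)  ≡⟨ interchange eF₀ eF₁ eG₀ eG₁ ⟩
  (eF₀ + eG₀) + (eF₁ + eG₁)  ≤⟨ +-mono-≤ (edges-supermodular (lower F) (lower G) y)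
                                          (edges-supermodular (upper F) (upper G) y) ⟩
  (e∨₀ + e∧₀) + (e∨₁ + e∧₁)  ≡⟨ interchange e∨₀ e∧₀ e∨₁ e∧₁ ⟩
  (e∨₀ + e∨₁) + (e∧₀ + e∧₁)  ∎
  where
  open ≤-Reasoning
  eF₀ = edges (lower F) y; eF₁ = edges (upper F) y
  eG₀ = edges (lower G) y; eG₁ = edges (upper G) y
  e∨₀ = edges (λ v → lower F v ∨ lower G v) y; e∨₁ = edges (λ v → upper F v ∨ upper G v) y
  e∧₀ = edges (λ v → lower F v ∧ lower G v) y; e∧₁ = edges (λ v → upper F v ∧ upper G v) y

LowerEnd : ∀ {a} → Family a → Fin a → Vec Bool a → Set
LowerEnd F y v = F v ≡ true × lookup v y ≡ false × F (v [ y ]≔ true) ≡ true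

edge-one : ∀ {a} (F : Family a) y v → LowerEnd F y v → 1 ≤ edges F y
edge-one F zero (false ∷ v) (Fv , _ , Fv′) = count-pos _ v (cong₂ _∧_ Fv Fv′)
edge-one F (suc y) (false ∷ v) e = ≤-trans (edge-one (lower F) y v e) (m≤m+n _ _)
edge-one F (suc y) (true ∷ v)  e = ≤-trans (edge-one (upper F) y v e) (m≤n+m _ _)

edge-two : ∀ {a} (F : Family a) y u v → LowerEnd F y u → LowerEnd F y v → u ≢ v → 2 ≤ edges F y
edge-two F zero (false ∷ u) (false ∷ v) (Fu , _ , Fu′) (Fv , _ , Fv′) u≢v =
  count-two _ u v (cong₂ _∧_ Fu Fu′) (cong₂ _∧_ Fv Fv′) (u≢v ∘ cong (false ∷_))
edge-two F (suc y) (false ∷ u) (false ∷ v) eu ev u≢v =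
  ≤-trans (edge-two (lower F) y u v eu ev (u≢v ∘ cong (false ∷_))) (m≤m+n _ _)
edge-two F (suc y) (true ∷ u)  (true ∷ v)  eu ev u≢v =
  ≤-trans (edge-two (upper F) y u v eu ev (u≢v ∘ cong (true ∷_))) (m≤n+m _ _)
edge-two F (suc y) (false ∷ u) (true ∷ v)  eu ev _ =
  +-mono-≤ (edge-one (lower F) y u eu) (edge-one (upper F) y v ev)
edge-two F (suc y) (true ∷ u)  (false ∷ v) eu ev _ =
  +-mono-≤ (edge-one (lower F) y v ev) (edge-one (upper F) y u eu)

sum-mono : ∀ {a} {f g : Fin a → ℕ} → (∀ y → f y ≤ g y) → sum f ≤ sum g
sum-mono {zero}  _   = z≤n
sum-mono {suc a} f≤g = +-mono-≤ (f≤g zero) (sum-mono (f≤g ∘ suc))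

occupied : ℕ → ℕ
occupied zero    = 0
occupied (suc _) = 1

occupied-subadditive : ∀ m n → occupied (m + n) ≤ occupied m + occupied n
occupied-subadditive zero    n = ≤-refl
occupied-subadditive (suc m) n = s≤s z≤n

-- Induction on
-- the first coordinate: direction 0 is occupied only if both faces are
-- nonempty, and the other directions are occupied by edges of the faces.
occupied-directions : ∀ {a} (M : Family a) → sum (λ y → occupied (edges M y)) ≤ ∣ M ∣ᶠ ∸ 1
occupied-directions {zero}  M = z≤n
occupied-directions {suc a} M = begin
  occupied c + sum (λ y → occupied (e₀ y + e₁ y))
    ≤⟨ +-monoʳ-≤ (occupied c) (sum-mono λ y → occupied-subadditive (e₀ y) (e₁ y)) ⟩
  occupied c + sum (λ y → occupied (e₀ y) + occupied (e₁ y))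
    ≡⟨ cong (occupied c +_) (∑-distrib-+ (λ y → occupied (e₀ y)) (λ y → occupied (e₁ y))) ⟩
  occupied c + (sum (λ y → occupied (e₀ y)) + sum (λ y → occupied (e₁ y)))
    ≤⟨ +-monoʳ-≤ (occupied c) (+-mono-≤ (occupied-directions (lower M)) (occupied-directions (upper M))) ⟩
  occupied c + ((∣ lower M ∣ᶠ ∸ 1) + (∣ upper M ∣ᶠ ∸ 1))
    ≤⟨ arith (count-mono ∧-lower) (count-mono ∧-upper) ⟩
  (∣ lower M ∣ᶠ + ∣ upper M ∣ᶠ) ∸ 1 ∎
  where
  open ≤-Reasoning
  c  = ∣ (λ v → lower M v ∧ upper M v) ∣ᶠ
  e₀ = edges (lower M)
  e₁ = edges (upper M)
  ∧-lower : ∀ v → lower M v ∧ upper M v ≡ true → lower M v ≡ true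
  ∧-lower v p with lower M v
  ... | true = refl
  ∧-upper : ∀ v → lower M v ∧ upper M v ≡ true → upper M v ≡ true
  ∧-upper v p with lower M v
  ... | true = p
  arith : ∀ {c x y} → c ≤ x → c ≤ y → occupied c + ((x ∸ 1) + (y ∸ 1)) ≤ (x + y) ∸ 1
  arith {x = zero}           z≤n _   = ≤-refl
  arith {x = suc x} {zero}   _   z≤n = ≤-refl
  arith {c} {suc x} {suc y}  _   _   = begin
    occupied c + (x + y) ≤⟨ +-monoˡ-≤ (x + y) (occupied≤1 c) ⟩
    suc (x + y)          ≡⟨ +-suc x y ⟨
    x + suc y            ∎
    where
    occupied≤1 : ∀ c → occupied c ≤ 1
    occupied≤1 zero    = z≤n
    occupied≤1 (suc _) = ≤-refl

weight : ℕ → ℕ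
weight zero          = 0
weight (suc zero)    = 2
weight (suc (suc _)) = 3

weight-mono : ∀ {m n} → m ≤ n → weight m ≤ weight n
weight-mono {zero}                    _               = z≤n
weight-mono {suc zero}    {suc zero}    _             = ≤-refl
weight-mono {suc zero}    {suc (suc _)} _             = s≤s (s≤s z≤n)
weight-mono {suc (suc _)} {suc (suc _)} _             = ≤-refl
weight-mono {suc (suc _)} {suc zero}    (s≤s ())

weight≤3 : ∀ c → weight c ≤ 3
weight≤3 zero          = z≤n
weight≤3 (suc zero)    = s≤s (s≤s z≤n)
weight≤3 (suc (suc _)) = ≤-refl

weight-suc : ∀ c → weight (suc c) ≤ 2 + c
weight-suc zero    = ≤-refl
weight-suc (suc c) = s≤s (s≤s (s≤s z≤n))

-- Pointwise step of the induction below: the edges of the two faces,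
-- bounded via supermodularity by those of their union and intersection.
weight-split : ∀ a b {u m} → a + b ≤ u + m → m ≤ u → weight (a + b) ≤ weight u + occupied m
weight-split a b {u}     {zero}  ab≤u _   =
  ≤-trans (weight-mono (≤-trans ab≤u (≤-reflexive (+-identityʳ u)))) (m≤m+n _ 0)
weight-split a b {suc u} {suc m} _    _   = ≤-trans (weight≤3 _) (weight-suc-occupied u)
  where
  weight-suc-occupied : ∀ u → 3 ≤ weight (suc u) + 1
  weight-suc-occupied zero    = ≤-refl
  weight-suc-occupied (suc u) = s≤s (s≤s (s≤s z≤n))

-- Induction on the first coordinate,
-- comparing the faces A, B with A ∪ B and A ∩ B; the edges in direction 0
-- are exactly the points of A ∩ B.
hypercube-inequality : ∀ {a} (F : Family a) → sum (λ y → weight (edges F y)) ≤ 2 * (∣ F ∣ᶠ ∸ 1)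
hypercube-inequality {zero}  F = z≤n
hypercube-inequality {suc a} F = begin
  weight ∣ M ∣ᶠ + sum (λ y → weight (edges A y + edges B y))
    ≤⟨ +-monoʳ-≤ (weight ∣ M ∣ᶠ) (sum-mono λ y →
         weight-split (edges A y) (edges B y) (edges-supermodular A B y) (edges-mono M⊆U y)) ⟩
  weight ∣ M ∣ᶠ + sum (λ y → weight (edges U y) + occupied (edges M y))
    ≡⟨ cong (weight ∣ M ∣ᶠ +_) (∑-distrib-+ (λ y → weight (edges U y)) (λ y → occupied (edges M y))) ⟩
  weight ∣ M ∣ᶠ + (sum (λ y → weight (edges U y)) + sum (λ y → occupied (edges M y)))
    ≤⟨ +-monoʳ-≤ (weight ∣ M ∣ᶠ) (+-mono-≤ (hypercube-inequality U) (occupied-directions M)) ⟩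
  weight ∣ M ∣ᶠ + (2 * (∣ U ∣ᶠ ∸ 1) + (∣ M ∣ᶠ ∸ 1))
    ≤⟨ arith (count-mono M⊆U) ⟩
  2 * ((∣ U ∣ᶠ + ∣ M ∣ᶠ) ∸ 1)
    ≡⟨ cong (λ t → 2 * (t ∸ 1)) (count-∨∧ A B) ⟩
  2 * ((∣ A ∣ᶠ + ∣ B ∣ᶠ) ∸ 1) ∎
  where
  open ≤-Reasoning
  A B U M : Family a
  A = lower F
  B = upper F
  U v = A v ∨ B v
  M v = A v ∧ B v
  M⊆U : ∀ v → M v ≡ true → U v ≡ true
  M⊆U v p with A v
  ... | true = refl
  arith : ∀ {m u} → m ≤ u → weight m + (2 * (u ∸ 1) + (m ∸ 1)) ≤ 2 * ((u + m) ∸ 1)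
  arith {zero} {u} _ =
    ≤-reflexive (trans (+-identityʳ (2 * (u ∸ 1))) (cong (λ t → 2 * (t ∸ 1)) (sym (+-identityʳ u))))
  arith {suc m} {suc u} _ = begin
    weight (suc m) + (2 * u + m) ≤⟨ +-monoˡ-≤ (2 * u + m) (weight-suc m) ⟩
    (2 + m) + (2 * u + m)        ≡⟨ regroup m u ⟩
    2 * (u + suc m)              ∎
    where
    regroup : ∀ m u → (2 + m) + (2 * u + m) ≡ 2 * (u + suc m)
    regroup = solve-∀

_≟ᵛ_ : ∀ {a} → DecidableEquality (Vec Bool a)
_≟ᵛ_ = ≡-dec Bool._≟_

count-point : ∀ {a} (w : Vec Bool a) → ∣ (λ v → does (v ≟ᵛ w)) ∣ᶠ ≡ 1
count-point []          = refl
count-point {suc a} (false ∷ w) = cong₂ _+_ (count-point w) (∑cube-0 {a})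
count-point {suc a} (true ∷ w)  = cong₂ _+_ (∑cube-0 {a}) (count-point w)

count-listed : ∀ {a} (vs : List (Vec Bool a)) → ∣ (λ v → does (any? (v ≟ᵛ_) vs)) ∣ᶠ ≤ length vs
count-listed {a} []       = ≤-reflexive (∑cube-0 {a})
count-listed     (w ∷ ws) =
  ≤-trans (count-∨ (λ v → does (v ≟ᵛ w)) (λ v → does (any? (v ≟ᵛ_) ws)))
          (+-mono-≤ (≤-reflexive (count-point w)) (count-listed ws))

members : ∀ {n} → Subset n → List (Fin n)
members []          = []
members (inside ∷ p)  = zero ∷ map suc (members p)
members (outside ∷ p) = map suc (members p)

length-members : ∀ {n} (p : Subset n) → length (members p) ≡ ∣ p ∣
length-members []            = refl
length-members (inside ∷ p)  = cong suc (trans (length-map suc (members p)) (length-members p))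
length-members (outside ∷ p) = trans (length-map suc (members p)) (length-members p)

members-complete : ∀ {n} {p : Subset n} {z} → z ∈ p → z ∈ˡ members p
members-complete {p = inside ∷ p}  here       = here refl
members-complete {p = inside ∷ p}  (there z∈p) = there (∈-map⁺ suc (members-complete z∈p))
members-complete {p = outside ∷ p} (there z∈p) = ∈-map⁺ suc (members-complete z∈p)

members-sound : ∀ {n} {p : Subset n} {z} → z ∈ˡ members p → z ∈ p
members-sound {p = inside ∷ p}  (here refl) = here
members-sound {p = inside ∷ p}  (there m) with ∈-map⁻ suc m
... | z , m′ , refl = there (members-sound m′)
members-sound {p = outside ∷ p} m with ∈-map⁻ suc m
... | z , m′ , refl = there (members-sound m′)

∣p∪q∣≤∣p∣+∣q∣ : ∀ {n} (p q : Subset n) → ∣ p ∪ q ∣ ≤ ∣ p ∣ + ∣ q ∣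
∣p∪q∣≤∣p∣+∣q∣ []            []            = z≤n
∣p∪q∣≤∣p∣+∣q∣ (inside ∷ p)  (inside ∷ q)  = s≤s (≤-trans (∣p∪q∣≤∣p∣+∣q∣ p q) (+-monoʳ-≤ ∣ p ∣ (n≤1+n ∣ q ∣)))
∣p∪q∣≤∣p∣+∣q∣ (inside ∷ p)  (outside ∷ q) = s≤s (∣p∪q∣≤∣p∣+∣q∣ p q)
∣p∪q∣≤∣p∣+∣q∣ (outside ∷ p) (inside ∷ q)  = ≤-trans (s≤s (∣p∪q∣≤∣p∣+∣q∣ p q)) (≤-reflexive (sym (+-suc ∣ p ∣ ∣ q ∣)))
∣p∪q∣≤∣p∣+∣q∣ (outside ∷ p) (outside ∷ q) = ∣p∪q∣≤∣p∣+∣q∣ p q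

sum-over-subset : ∀ {n} (f : Fin n → ℕ) (D : Subset n) {c} →
  (∀ x → x ∈ D → c ≤ f x) → c * ∣ D ∣ ≤ sum f
sum-over-subset {zero}  f []            {c} _ = ≤-reflexive (*-zeroʳ c)
sum-over-subset {suc n} f (inside ∷ D)  {c} c≤f = begin
  c * suc ∣ D ∣       ≡⟨ *-suc c ∣ D ∣ ⟩
  c + c * ∣ D ∣       ≤⟨ +-mono-≤ (c≤f zero here) (sum-over-subset (f ∘ suc) D (λ x → c≤f (suc x) ∘ there)) ⟩
  f zero + sum (f ∘ suc) ∎
  where open ≤-Reasoning
sum-over-subset {suc n} f (outside ∷ D) c≤f =
  ≤-trans (sum-over-subset (f ∘ suc) D (λ x → c≤f (suc x) ∘ there)) (m≤n+m _ _)

∣p∣+∣∁p∣≡n : ∀ {n} (p : Subset n) → ∣ p ∣ + ∣ ∁ p ∣ ≡ n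
∣p∣+∣∁p∣≡n p = trans (cong (∣ p ∣ +_) (∣∁p∣≡n∸∣p∣ p)) (m+[n∸m]≡n (∣p∣≤n p))

another-element : ∀ {n} (D : Subset n) → 2 ≤ ∣ D ∣ → ∀ x → x ∈ D → ∃ λ w → w ∈ D × w ≢ x
another-element D 2≤∣D∣ x x∈D with Fin.any? (λ w → (w ∈? D) ×-dec ¬? (w ≟ x))
... | yes found = found
... | no  none  = ⊥-elim (<-irrefl refl (≤-trans 2≤∣D∣ (≤-trans (p⊆q⇒∣p∣≤∣q∣ D⊆⁅x⁆) (≤-reflexive (∣⁅x⁆∣≡1 x)))))
  where
  D⊆⁅x⁆ : ∀ {w} → w ∈ D → w ∈ ⁅ x ⁆
  D⊆⁅x⁆ {w} w∈D with w ≟ x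
  ... | yes refl = x∈⁅x⁆ x
  ... | no  w≢x  = ⊥-elim (none (w , w∈D , w≢x))


Separating : ∀ {n} → Graph n → Subset n → Set
Separating G S = ∀ u v → u ∉ S → v ∉ S → u ≢ v → ¬ (∀ w → w ∈ S → adj G u w ≡ adj G v w)

CoDominating : ∀ {n} → Graph n → Subset n → Set
CoDominating G S = ∀ v → v ∉ S → ∃ λ w → w ∈ S × adj G v w ≡ false

Stable : ∀ {n} → Graph n → (Fin n → Set) → Set
Stable G P = ∀ u w → P u → P w → adj G u w ≡ false

LD⇒separating : ∀ {n} {G : Graph n} {S} → IsLD G S → Separating G S
LD⇒separating (_ , locating) u v u∉S v∉S u≢v agree =
  locating u v u∉S v∉S u≢v λ w w∈S → (λ p → trans (sym (agree w w∈S)) p) , trans (agree w w∈S)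

adj-complement : ∀ {n} (G : Graph n) {u w} → u ≢ w → adj (complement G) u w ≡ not (adj G u w)
adj-complement G {u} {w} u≢w = unfolded
  where
  unfolded : not (adj G u w) ∧ not ⌊ u ≟ w ⌋ ≡ not (adj G u w)
  unfolded with u ≟ w
  ... | yes u≡w = ⊥-elim (u≢w u≡w)
  ... | no  _   = Bool.∧-identityʳ (not (adj G u w))

-- Adjacency to S and non-adjacency to S carry the same information, so a
-- separating set of G which co-dominates G is locating-dominating in Ḡ.
complement-LD : ∀ {n} (G : Graph n) {S} → CoDominating G S → Separating G S → IsLD (complement G) S
complement-LD G {S} codom sep = dominating , locating
  where
  apart : ∀ {v w} → v ∉ S → w ∈ S → v ≢ w
  apart v∉S w∈S refl = v∉S w∈S
  dominating : ∀ v → v ∉ S → ∃ λ w → w ∈ S × Adj (complement G) v w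
  dominating v v∉S with codom v v∉S
  ... | w , w∈S , vw = w , w∈S , trans (adj-complement G (apart v∉S w∈S)) (cong not vw)
  locating : ∀ u v → u ∉ S → v ∉ S → u ≢ v →
    ¬ (∀ w → w ∈ S → (Adj (complement G) u w → Adj (complement G) v w) × (Adj (complement G) v w → Adj (complement G) u w))
  locating u v u∉S v∉S u≢v same = sep u v u∉S v∉S u≢v λ w w∈S →
    let (to , from) = same w w∈S in
    Bool.not-injective (Bool.⇔→≡ (subst₂ (λ a b → (a ≡ true) ⇔ (b ≡ true))
      (adj-complement G (apart u∉S w∈S)) (adj-complement G (apart v∉S w∈S)) (mk⇔ to from)))

-- If every LD-set of Ḡ is larger than the LD-set D of G, then some vertex
-- outside D is adjacent to all of D: otherwise D itself is LD in Ḡ.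
dominator : ∀ {n} (G : Graph n) {D} → IsLD G D → (∀ S → IsLD (complement G) S → ∣ D ∣ < ∣ S ∣) →
  ∃ λ v → v ∉ D × ∀ w → w ∈ D → adj G v w ≡ true
dominator {n} G {D} D-LD larger with Fin.any? (λ v → ¬? (v ∈? D) ×-dec Fin.all? (λ w → w ∈? D →-dec adj G v w Bool.≟ true))
... | yes found = found
... | no none   = ⊥-elim (<-irrefl refl (larger D (complement-LD G codominating (LD⇒separating {G = G} D-LD))))
  where
  codominating : CoDominating G D
  codominating v v∉D with Fin.¬∀⟶∃¬ n _ (λ w → w ∈? D →-dec adj G v w Bool.≟ true) (λ all → none (v , v∉D , all))
  ... | w , ¬vw with w ∈? D
  ...   | yes w∈D = w , w∈D , Bool.¬-not (λ vw → ¬vw (λ _ → vw))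
  ...   | no  w∉D = ⊥-elim (¬vw (⊥-elim ∘ w∉D))

nbhd : ∀ {n} → Graph n → Fin n → Vec Bool n
nbhd G z = tabulate (adj G z)

-- The neighbourhoods of the vertices
-- outside D form a family of ∣∁D∣ points of the cube whose edges in every
-- direction x ∈ D number at least two: otherwise x can be exchanged for a
-- suitable y ∉ D, producing an LD-set of Ḡ of size ∣D∣.
module Exchange {n} (G : Graph n) (D : Subset n)
  (separates : Separating G D)
  (D-stable : Stable G (_∈ D))
  (∁D-stable : Stable G (_∉ D))
  (v₀ : Fin n) (v₀∉D : v₀ ∉ D) (v₀-dominates : ∀ w → w ∈ D → adj G v₀ w ≡ true)
  (partner : ∀ x → x ∈ D → ∃ λ w → w ∈ D × w ≢ x)
  (larger : ∀ S → IsLD (complement G) S → ∣ D ∣ < ∣ S ∣)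
  where

  N : Fin n → Vec Bool n
  N = nbhd G

  N-lookup : ∀ z w → lookup (N z) w ≡ adj G z w
  N-lookup z = lookup∘tabulate (adj G z)

  N-injective : ∀ {u v} → u ∉ D → v ∉ D → N u ≡ N v → u ≡ v
  N-injective {u} {v} u∉D v∉D Nu≡Nv with u ≟ v
  ... | yes u≡v = u≡v
  ... | no  u≢v = ⊥-elim (separates u v u∉D v∉D u≢v λ w _ →
                    trans (sym (N-lookup u w)) (trans (cong (λ t → lookup t w) Nu≡Nv) (N-lookup v w)))

  family : Family n
  family v = does (any? (v ≟ᵛ_) (map N (members (∁ D))))

  family-∋ : ∀ {z} → z ∉ D → family (N z) ≡ true
  family-∋ z∉D = dec-true (any? _ _) (∈-map⁺ N (members-complete (x∉p⇒x∈∁p z∉D)))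

  family-∈ : ∀ v → family v ≡ true → ∃ λ z → z ∉ D × N z ≡ v
  family-∈ v v∈F with any? (v ≟ᵛ_) (map N (members (∁ D)))
  ... | yes v∈ with ∈-map⁻ N v∈
  ...   | z , z∈ , v≡Nz = z , x∈∁p⇒x∉p (members-sound z∈) , sym v≡Nz

  family-size : ∣ family ∣ᶠ ≤ ∣ ∁ D ∣
  family-size = ≤-trans (count-listed (map N (members (∁ D))))
                        (≤-reflexive (trans (length-map N (members (∁ D))) (length-members (∁ D))))

  -- N(v) = N(u) ∪ {x}: u and v agree off x, and only v is adjacent to x.
  Raised : Fin n → Fin n → Fin n → Set
  Raised x u v = adj G u x ≡ false × adj G v x ≡ true × (∀ w → w ≢ x → adj G u w ≡ adj G v w)

  raised-N : ∀ {x u v} → Raised x u v → N v ≡ N u [ x ]≔ true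
  raised-N {x} {u} {v} (_ , vx , off-x) = begin
    tabulate (adj G v)                  ≡⟨ tabulate-cong pointwise ⟩
    tabulate (lookup (N u [ x ]≔ true)) ≡⟨ tabulate∘lookup (N u [ x ]≔ true) ⟩
    N u [ x ]≔ true                     ∎
    where
    open ≡-Reasoning
    pointwise : ∀ w → adj G v w ≡ lookup (N u [ x ]≔ true) w
    pointwise w with w ≟ x
    ... | yes refl = trans vx (sym (lookup∘update x (N u) true))
    ... | no  w≢x  = trans (sym (off-x w w≢x))
                       (trans (sym (N-lookup u w)) (sym (lookup∘update′ w≢x (N u) true)))

  lowerEnd : ∀ {x z} → z ∉ D → adj G z x ≡ false → family (N z [ x ]≔ true) ≡ true →
    LowerEnd family x (N z)
  lowerEnd {x} {z} z∉D zx raised∈F = family-∋ z∉D , trans (N-lookup z x) zx , raised∈F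

  raised-lowerEnd : ∀ {x u v} → u ∉ D → v ∉ D → Raised x u v → LowerEnd family x (N u)
  raised-lowerEnd u∉D v∉D r@(ux , _ , _) =
    lowerEnd u∉D ux (subst (λ t → family t ≡ true) (raised-N r) (family-∋ v∉D))

  -- y is the upper end of every edge of the family in direction x.
  Top : Fin n → Fin n → Set
  Top x y = ∀ u v → u ∉ D → v ∉ D → Raised x u v → v ≡ y

  -- With at most one edge in direction x there is such a y adjacent to x:
  -- the upper end of that edge, or v₀ if there is none.
  top-exists : ∀ {x} → x ∈ D → edges family x ≤ 1 → ∃ λ y → y ∉ D × adj G x y ≡ true × Top x y
  top-exists {x} x∈D ≤1
    with Fin.any? (λ z → ¬? (z ∈? D) ×-dec (adj G z x Bool.≟ false) ×-dec (family (N z [ x ]≔ true) Bool.≟ true))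
  ... | no no-edge = v₀ , v₀∉D , trans (Graph.sym G x v₀) (v₀-dominates x x∈D) , top
    where
    top : Top x v₀
    top u v u∉D v∉D r = ⊥-elim (no-edge (u , u∉D , proj₁ r , proj₂ (proj₂ (raised-lowerEnd u∉D v∉D r))))
  ... | yes (z , z∉D , zx , raised∈F) with family-∈ _ raised∈F
  ...   | y , y∉D , Ny≡ = y , y∉D , xy , top
    where
    xy : adj G x y ≡ true
    xy = begin
      adj G x y                   ≡⟨ Graph.sym G x y ⟩
      adj G y x                   ≡⟨ N-lookup y x ⟨
      lookup (N y) x              ≡⟨ cong (λ t → lookup t x) Ny≡ ⟩
      lookup (N z [ x ]≔ true) x  ≡⟨ lookup∘update x (N z) true ⟩
      true                        ∎
      where open ≡-Reasoning
    top : Top x y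
    top u v u∉D v∉D r with N u ≟ᵛ N z
    ... | yes Nu≡Nz = N-injective v∉D y∉D (trans (raised-N r) (trans (cong (_[ x ]≔ true) Nu≡Nz) (sym Ny≡)))
    ... | no  Nu≢Nz = ⊥-elim (<-irrefl refl (≤-trans
            (edge-two family x (N z) (N u) (lowerEnd z∉D zx raised∈F) (raised-lowerEnd u∉D v∉D r) (Nu≢Nz ∘ sym))
            ≤1))

  exchange-LD : ∀ {x y} → x ∈ D → y ∉ D → adj G x y ≡ true → Top x y →
    IsLD (complement G) ((D - x) ∪ ⁅ y ⁆)
  exchange-LD {x} {y} x∈D y∉D xy top = complement-LD G codominating separating
    where
    S = (D - x) ∪ ⁅ y ⁆

    y∈S : y ∈ S
    y∈S = x∈p∪q⁺ (inj₂ (x∈⁅x⁆ y))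

    D-x⊆S : ∀ {w} → w ∈ D → w ≢ x → w ∈ S
    D-x⊆S w∈D w≢x = x∈p∪q⁺ (inj₁ (x∈p∧x≢y⇒x∈p-y w∈D w≢x))

    outside-S : ∀ v → v ∉ S → v ≡ x ⊎ (v ∉ D × v ≢ y)
    outside-S v v∉S with v ∈? D | v ≟ x
    ... | _       | yes v≡x = inj₁ v≡x
    ... | yes v∈D | no  v≢x = ⊥-elim (v∉S (D-x⊆S v∈D v≢x))
    ... | no  v∉D | no  _   = inj₂ (v∉D , λ { refl → v∉S y∈S })

    -- x is not adjacent to its partner in D; any other v ∉ S is not
    -- adjacent to y.
    codominating : CoDominating G S
    codominating v v∉S with outside-S v v∉S
    ... | inj₁ refl with partner x x∈D
    ...   | w , w∈D , w≢x = w , D-x⊆S w∈D w≢x , D-stable x w x∈D w∈D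
    codominating v v∉S | inj₂ (v∉D , _) = y , y∈S , ∁D-stable v y v∉D y∉D

    x-vs-outside : ∀ {v} → v ∉ D → adj G x y ≢ adj G v y
    x-vs-outside {v} v∉D same with () ← trans (sym xy) (trans same (∁D-stable v y v∉D y∉D))

    agree-off-x : ∀ {u v} → u ∉ D → v ∉ D → (∀ w → w ∈ S → adj G u w ≡ adj G v w) →
      ∀ w → w ≢ x → adj G u w ≡ adj G v w
    agree-off-x {u} {v} u∉D v∉D agree w w≢x with w ∈? D
    ... | yes w∈D = agree w (D-x⊆S w∈D w≢x)
    ... | no  w∉D = trans (∁D-stable u w u∉D w∉D) (sym (∁D-stable v w v∉D w∉D))

    agree-on-D : ∀ {u v} → u ∉ D → v ∉ D → (∀ w → w ∈ S → adj G u w ≡ adj G v w) →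
      adj G u x ≡ adj G v x → ∀ w → w ∈ D → adj G u w ≡ adj G v w
    agree-on-D u∉D v∉D agree at-x w _ with w ≟ x
    ... | yes refl = at-x
    ... | no  w≢x  = agree-off-x u∉D v∉D agree w w≢x

    -- Two vertices outside D ∪ {y} which agree on S cannot agree at x
    -- (D separates) nor differ there (the only top is y).
    two-outside : ∀ u v → u ∉ D → v ∉ D → u ≢ y → v ≢ y → u ≢ v →
      (∀ w → w ∈ S → adj G u w ≡ adj G v w) → ⊥
    two-outside u v u∉D v∉D u≢y v≢y u≢v agree with adj G u x in ux | adj G v x in vx
    ... | true  | true  = separates u v u∉D v∉D u≢v (agree-on-D u∉D v∉D agree (trans ux (sym vx)))
    ... | false | false = separates u v u∉D v∉D u≢v (agree-on-D u∉D v∉D agree (trans ux (sym vx)))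
    ... | false | true  = v≢y (top u v u∉D v∉D (ux , vx , agree-off-x u∉D v∉D agree))
    ... | true  | false = u≢y (top v u v∉D u∉D (vx , ux , λ w w≢x → sym (agree-off-x u∉D v∉D agree w w≢x)))

    separating : Separating G S
    separating u v u∉S v∉S u≢v agree with outside-S u u∉S | outside-S v v∉S
    ... | inj₁ refl          | inj₁ refl          = u≢v refl
    ... | inj₁ refl          | inj₂ (v∉D , _)     = x-vs-outside v∉D (agree y y∈S)
    ... | inj₂ (u∉D , _)     | inj₁ refl          = x-vs-outside u∉D (sym (agree y y∈S))
    ... | inj₂ (u∉D , u≢y)   | inj₂ (v∉D , v≢y)   = two-outside u v u∉D v∉D u≢y v≢y u≢v agree

  exchange-size : ∀ {x} y → x ∈ D → ∣ (D - x) ∪ ⁅ y ⁆ ∣ ≤ ∣ D ∣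
  exchange-size {x} y x∈D = begin
    ∣ (D - x) ∪ ⁅ y ⁆ ∣    ≤⟨ ∣p∪q∣≤∣p∣+∣q∣ (D - x) ⁅ y ⁆ ⟩
    ∣ D - x ∣ + ∣ ⁅ y ⁆ ∣  ≡⟨ cong (∣ D - x ∣ +_) (∣⁅x⁆∣≡1 y) ⟩
    ∣ D - x ∣ + 1          ≡⟨ +-comm ∣ D - x ∣ 1 ⟩
    suc ∣ D - x ∣          ≤⟨ x∈p⇒∣p-x∣<∣p∣ x∈D ⟩
    ∣ D ∣                  ∎
    where open ≤-Reasoning

  two-edges : ∀ {x} → x ∈ D → 2 ≤ edges family x
  two-edges {x} x∈D with 2 ≤? edges family x
  ... | yes 2≤ = 2≤
  ... | no  2≰ with top-exists x∈D (s≤s⁻¹ (≰⇒> 2≰))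
  ...   | y , y∉D , xy , top =
    ⊥-elim (<-irrefl refl (<-≤-trans (larger _ (exchange-LD x∈D y∉D xy top)) (exchange-size y x∈D)))

  bound : 3 * ∣ D ∣ + 2 ≤ 2 * ∣ ∁ D ∣
  bound = begin
    3 * ∣ D ∣ + 2                            ≤⟨ +-monoˡ-≤ 2 (sum-over-subset _ D (λ x x∈D → weight-mono (two-edges x∈D))) ⟩
    sum (λ x → weight (edges family x)) + 2  ≤⟨ +-monoˡ-≤ 2 (hypercube-inequality family) ⟩
    2 * (∣ family ∣ᶠ ∸ 1) + 2                ≡⟨ double-pred (count-pos family (N v₀) (family-∋ v₀∉D)) ⟩
    2 * ∣ family ∣ᶠ                          ≤⟨ *-monoʳ-≤ 2 family-size ⟩
    2 * ∣ ∁ D ∣                              ∎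
    where
    open ≤-Reasoning
    double-pred : ∀ {c} → 1 ≤ c → 2 * (c ∸ 1) + 2 ≡ 2 * c
    double-pred {suc c} _ = regroup c
      where
      regroup : ∀ c → 2 * c + 2 ≡ 2 * suc c
      regroup = solve-∀

Proper : ∀ {n} → Graph n → (Fin n → Bool) → Set
Proper G c = ∀ u v → Adj G u v → c u ≢ c v

monochromatic-stable : ∀ {n} (G : Graph n) {c} → Proper G c → ∀ {P : Fin n → Set} b →
  (∀ z → P z → c z ≡ b) → Stable G P
monochromatic-stable G proper b mono u w Pu Pw =
  Bool.¬-not (λ uw → proper u w uw (trans (mono u Pu) (sym (mono w Pw))))

IsClass : ∀ {n} → (Fin n → Bool) → Subset n → Bool → Set
IsClass c P b = ∀ z → (z ∈ P → c z ≡ b) × (c z ≡ b → z ∈ P)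

complement-class : ∀ {n} {c : Fin n → Bool} {P b} → IsClass c P b → IsClass c (∁ P) (not b)
complement-class {c = c} {P} {b} class z = into , onto
  where
  into : z ∈ ∁ P → c z ≡ not b
  into z∈∁P = Bool.¬-not (x∈∁p⇒x∉p z∈∁P ∘ proj₂ (class z))
  onto : c z ≡ not b → z ∈ ∁ P
  onto cz = x∉p⇒x∈∁p λ z∈P → Bool.not-¬ (proj₁ (class z) z∈P) cz

opposite-class : ∀ {n} (G : Graph n) {c} → Proper G c → ∀ {D v₀} →
  (∀ v → v ∉ D → ∃ λ w → w ∈ D × Adj G v w) → (∀ w → w ∈ D → Adj G v₀ w) →
  IsClass c D (not (c v₀))
opposite-class G {c} proper {D} {v₀} dominating v₀-dominates z = opposite , onto
  where
  opposite : ∀ {w} → w ∈ D → c w ≡ not (c v₀)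
  opposite {w} w∈D = Bool.¬-not (λ same → proper v₀ w (v₀-dominates w w∈D) (sym same))
  onto : c z ≡ not (c v₀) → z ∈ D
  onto cz with z ∈? D
  ... | yes z∈D = z∈D
  ... | no  z∉D with dominating z z∉D
  ...   | w , w∈D , zw = ⊥-elim (proper z w zw (trans cz (sym (opposite w∈D))))

side : ∀ r {s} → Fin (r + s) → Bool
side r z with toℕ z <? r
... | yes _ = true
... | no  _ = false

bipartite-proper : ∀ r s (G : Graph (r + s)) → BipartiteUW r s G → Proper G (side r)
bipartite-proper r s G (U-stable , W-stable) u v uv with toℕ u <? r | toℕ v <? r
... | yes u∈U | yes v∈U = λ _ → U-stable u v u∈U v∈U uv
... | no  u∉U | no  v∉U = λ _ → W-stable u v u∉U v∉U uv
... | yes _   | no  _   = λ ()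
... | no  _   | yes _   = λ ()

U-size : ∀ r s (P : Subset (r + s)) → (∀ z → z ∈ P → toℕ z < r) → (∀ z → toℕ z < r → z ∈ P) → ∣ P ∣ ≡ r
U-size zero    s P P⊆U _ = ∣p∣≡0 P (λ z z∈P → n≮0 (P⊆U z z∈P))
  where
  ∣p∣≡0 : ∀ {n} (p : Subset n) → (∀ z → z ∉ p) → ∣ p ∣ ≡ 0
  ∣p∣≡0 [] _ = refl
  ∣p∣≡0 (outside ∷ p) empty = ∣p∣≡0 p (λ z → empty (suc z) ∘ there)
  ∣p∣≡0 (inside  ∷ p) empty = ⊥-elim (empty zero here)
U-size (suc r) s (inside ∷ P) P⊆U U⊆P =
  cong suc (U-size r s P (λ z z∈P → s≤s⁻¹ (P⊆U (suc z) (there z∈P))) (λ z z<r → drop-there (U⊆P (suc z) (s≤s z<r))))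
U-size (suc r) s (outside ∷ P) _ U⊆P with () ← U⊆P zero (s≤s z≤n)

U-class-size : ∀ r s {P : Subset (r + s)} → IsClass (side r) P true → ∣ P ∣ ≡ r
U-class-size r s {P} class = U-size r s P (λ z → in-U z ∘ proj₁ (class z)) (λ z → proj₂ (class z) ∘ U-in z)
  where
  in-U : ∀ z → side r z ≡ true → toℕ z < r
  in-U z _ with toℕ z <? r
  ... | yes z<r = z<r
  U-in : ∀ z → toℕ z < r → side r z ≡ true
  U-in z z<r with toℕ z <? r
  ... | yes _   = refl
  ... | no  z≮r = ⊥-elim (z≮r z<r)

class-sizes : ∀ r s {P : Subset (r + s)} {b} → IsClass (side r) P b →
  (∣ P ∣ ≡ r × ∣ ∁ P ∣ ≡ s) ⊎ (∣ P ∣ ≡ s × ∣ ∁ P ∣ ≡ r)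
class-sizes r s {P} {true}  class = inj₁ (∣P∣≡r , +-cancelˡ-≡ r _ _ (begin
  r + ∣ ∁ P ∣      ≡⟨ cong (_+ ∣ ∁ P ∣) ∣P∣≡r ⟨
  ∣ P ∣ + ∣ ∁ P ∣  ≡⟨ ∣p∣+∣∁p∣≡n P ⟩
  r + s            ∎))
  where
  open ≡-Reasoning
  ∣P∣≡r = U-class-size r s class
class-sizes r s {P} {false} class = inj₂ (+-cancelʳ-≡ r _ _ (begin
  ∣ P ∣ + r        ≡⟨ cong (∣ P ∣ +_) ∣∁P∣≡r ⟨
  ∣ P ∣ + ∣ ∁ P ∣  ≡⟨ ∣p∣+∣∁p∣≡n P ⟩
  r + s            ≡⟨ +-comm r s ⟩
  s + r            ∎) , ∣∁P∣≡r)
  where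
  open ≡-Reasoning
  ∣∁P∣≡r = U-class-size r s (complement-class class)

-- The main estimate: if D is an LD-set of the bipartite graph G and every
-- LD-set of Ḡ is larger than D, then a vertex v₀ dominates D, so D is a
-- whole side (the one opposite v₀) and the exchange argument applies.
side-bound : ∀ r s (G : Graph (r + s)) → 2 ≤ r → r ≤ s → BipartiteUW r s G → ∀ {D} → IsLD G D →
  (∀ S → IsLD (complement G) S → ∣ D ∣ < ∣ S ∣) → (3 * r + 2 ≤ 2 * s) ⊎ (3 * s + 2 ≤ 2 * r)
side-bound r s G 2≤r r≤s bipartite {D} D-LD larger =
  Data.Sum.map (λ (∣D∣≡r , ∣∁D∣≡s) → bound ∣D∣≡r ∣∁D∣≡s 2≤r)
               (λ (∣D∣≡s , ∣∁D∣≡r) → bound ∣D∣≡s ∣∁D∣≡r (≤-trans 2≤r r≤s))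
               (class-sizes r s D-class)
  where
  v₀ : Fin (r + s)
  v₀ = proj₁ (dominator G D-LD larger)
  v₀∉D : v₀ ∉ D
  v₀∉D = proj₁ (proj₂ (dominator G D-LD larger))
  v₀-dominates : ∀ w → w ∈ D → Adj G v₀ w
  v₀-dominates = proj₂ (proj₂ (dominator G D-LD larger))
  proper : Proper G (side r)
  proper = bipartite-proper r s G bipartite
  D-class : IsClass (side r) D (not (side r v₀))
  D-class = opposite-class G proper (proj₁ D-LD) v₀-dominates
  D-stable : Stable G (_∈ D)
  D-stable = monochromatic-stable G proper _ (λ z → proj₁ (D-class z))
  ∁D-stable : Stable G (_∉ D)
  ∁D-stable = monochromatic-stable G proper _ (λ z → proj₁ (complement-class D-class z) ∘ x∉p⇒x∈∁p)
  bound : ∀ {a b} → ∣ D ∣ ≡ a → ∣ ∁ D ∣ ≡ b → 2 ≤ a → 3 * a + 2 ≤ 2 * b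
  bound refl refl 2≤∣D∣ = Exchange.bound G D (LD⇒separating {G = G} D-LD) D-stable ∁D-stable
    v₀ v₀∉D v₀-dominates (another-element D 2≤∣D∣) larger

-- Proposition 4.9: with 3 ≤ r ≤ s and 2s < 3r + 2, both alternatives of side-bound fail.
proposition4p9 : (r s : ℕ) → 3 ≤ r → r ≤ s → 3 * r ≤ 2 * s → 2 * s < 3 * r + 2 →
    (G : Graph (r + s)) → BipartiteUW r s G → Connected G →
    (k : ℕ) → IsLDNumber G k → IsLDNumber (complement G) (suc k) → ⊥
proposition4p9 r s 3≤r r≤s _ 2s<3r+2 G bipartite _ k ((D , D-LD , ∣D∣≡k) , _) (_ , λḠ>k) =
  impossible (side-bound r s G (≤-trans (n≤1+n 2) 3≤r) r≤s bipartite D-LD larger)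
  where
  larger : ∀ S → IsLD (complement G) S → ∣ D ∣ < ∣ S ∣
  larger S S-LD = subst (_< ∣ S ∣) (sym ∣D∣≡k) (λḠ>k S S-LD)
  impossible : (3 * r + 2 ≤ 2 * s) ⊎ (3 * s + 2 ≤ 2 * r) → ⊥
  impossible (inj₁ 3r+2≤2s) = <-irrefl refl (<-≤-trans 2s<3r+2 3r+2≤2s)
  impossible (inj₂ 3s+2≤2r) = <-irrefl refl (<-≤-trans (m<m+n (3 * s) (s≤s z≤n)) (begin
    3 * s + 2 ≤⟨ 3s+2≤2r ⟩
    2 * r     ≤⟨ *-monoʳ-≤ 2 r≤s ⟩
    2 * s     ≤⟨ *-monoˡ-≤ s (n≤1+n 2) ⟩
    3 * s     ∎))
    where open ≤-Reasoning
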